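{- For every positive integer $n$, $B'(K_{n,n})=\binom{n+1}{2}-1$.
   Context: $K_{n,n}$ is the complete bipartite graph with both parts of size $n$. An edge-numbering of a graph $G$ is an assignment $f$ of distinct integers to the edges; $B'(f)$ is the maximum of $|f(e)-f(e')|$ over pairs of distinct incident edges $e,e'$. The edge-bandwidth $B'(G)$ is the minimum of $B'(f)$ over all edge-numberings $f$ of $G$. -}

module Defs where

open import Data.Nat using (ℕ; _⊔_; _≤_)
open import Data.Integer using (ℤ; _-_; ∣_∣)
open import Data.Fin using (Fin)
open import Data.Fin.Properties using () renaming (_≟_ to _≟F_)
open import Data.Product using (_×_; _,_; Σ; proj₁; proj₂)
open import Data.Product.Properties using (≡-dec)
open import Data.Sum using (_⊎_)
open import Data.List using (List; allFin; cartesianProduct; foldr; map)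
open import Relation.Binary.PropositionalEquality using (_≡_; _≢_)
open import Relation.Nullary using (Dec; yes; no; ¬_)
open import Relation.Nullary.Decidable using (_×-dec_; _⊎-dec_; ¬?)
open import Function.Definitions using (Injective)

-- Edges of K_{n,n}: the edge (i , j) joins vertex i of the left part
-- to vertex j of the right part.
Edge : ℕ → Set
Edge n = Fin n × Fin n

_≟E_ : ∀ {n} (e e' : Edge n) → Dec (e ≡ e')
_≟E_ = ≡-dec _≟F_ _≟F_

IncidentDistinct : ∀ {n} → Edge n → Edge n → Set
IncidentDistinct e e' = e ≢ e' × (proj₁ e ≡ proj₁ e' ⊎ proj₂ e ≡ proj₂ e')

incidentDistinct? : ∀ {n} (e e' : Edge n) → Dec (IncidentDistinct e e')
incidentDistinct? e e' =
  ¬? (e ≟E e') ×-dec ((proj₁ e ≟F proj₁ e') ⊎-dec (proj₂ e ≟F proj₂ e'))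

allEdges : ∀ n → List (Edge n)
allEdges n = cartesianProduct (allFin n) (allFin n)

EdgeNumbering : ℕ → Set
EdgeNumbering n = Σ (Edge n → ℤ) λ f → Injective _≡_ _≡_ f

pairCost : ∀ {n} → (Edge n → ℤ) → Edge n × Edge n → ℕ
pairCost f (e , e') with incidentDistinct? e e'
... | yes _ = ∣ f e - f e' ∣
... | no  _ = 0

B'f : ∀ {n} → EdgeNumbering n → ℕ
B'f {n} (f , _) = foldr _⊔_ 0 (map (pairCost f) (cartesianProduct (allEdges n) (allEdges n)))

IsEdgeBandwidthKnn : ℕ → ℕ → Set
IsEdgeBandwidthKnn n k =
  Σ (EdgeNumbering n) (λ f → B'f f ≡ k) × (∀ (f : EdgeNumbering n) → k ≤ B'f f)

-- Number the edges injectively by naturals and sweep a threshold t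
-- upwards.  At the last t for which the rows and columns meeting an edge numbered
-- below t number at most n, at most n²/4 + 1 edges are numbered below t + 1 and, as
-- the rows and columns met at t + 1 number at least n + 1, at most (n - 1)²/4 edges
-- avoid them.  The remaining edges, which are not below t + 1 but share a vertex
-- with an edge that is, carry distinct numbers in a window of width B above t, so
-- there are at most B of them; counting gives B ≥ C(n + 1, 2) - 1.
--
-- The cells x + y < n of the grid are numbered 0, ..., W - 1 with
-- W = C(n + 1, 2) shell by shell, shell k holding the cells with max (x , y) = k;
-- the other cells form a staircase of size n - 1, numbered W, ..., n² - 1 in reverse
-- shell order.  Every row and column then spans fewer than W numbers.

module Submission where

open import Defs
open import Algebra.Bundles using (AbelianGroup)
open import Data.Empty using (⊥; ⊥-elim)
open import Data.Fin as Fin using (Fin; toℕ)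
open import Data.Fin.Properties using (any?; toℕ-injective; toℕ≤pred[n])
open import Data.Integer as ℤ using (ℤ; +_; -[1+_]; 0ℤ; ∣_∣; _⊖_)
import Data.Integer.Properties as ℤ
import Data.Integer.Tactic.RingSolver as ℤ-Solver
open import Data.List using (List; []; _∷_; _++_; map; length; foldr; allFin; cartesianProduct)
open import Data.List.Properties using (length-tabulate)
open import Data.List.Membership.Propositional using (_∈_)
open import Data.List.Membership.Propositional.Properties using (∈-cartesianProduct⁺; ∈-allFin)
open import Data.List.Relation.Unary.All using (All; []; _∷_)
open import Data.List.Relation.Unary.AllPairs using ([]; _∷_)
open import Data.List.Relation.Unary.Any using (here; there)
open import Data.List.Relation.Unary.Unique.Propositional using (Unique)
open import Data.List.Relation.Unary.Unique.Propositional.Properties using (cartesianProduct⁺; allFin⁺)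
open import Data.Nat using (ℕ; zero; suc; pred; _+_; _*_; _∸_; _⊓_; _⊔_; _≤_; _<_; z≤n; s≤s; s≤s⁻¹; _≟_; _≤?_; _<?_)
open import Data.Nat.Combinatorics using (_C_; nC1≡n; nCk+nC[k+1]≡[n+1]C[k+1])
open import Data.Nat.Properties
open import Data.Nat.Tactic.RingSolver using (solve-∀)
open import Data.Product using (_×_; _,_; proj₁; proj₂; ∃-syntax)
open import Data.Sum using (_⊎_; inj₁; inj₂; [_,_]′)
open import Function using (_∘_)
open import Function.Definitions using (Injective)
open import Relation.Binary.Definitions using (tri<; tri≈; tri>)
open import Relation.Binary.PropositionalEquality
open import Relation.Nullary using (¬_; Dec; yes; no; contradiction)
open import Relation.Nullary.Decidable using (_×-dec_; _⊎-dec_)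
open import Relation.Unary using (Pred; Decidable; _⊆_; _∪_; _∩_; ∁)
open import Relation.Unary.Properties using (_∪?_; _∩?_; ∁?; _×?_; U?)
open import Algebra.Properties.Group (AbelianGroup.group ℤ.+-0-abelianGroup) using () renaming (∙-cancelʳ to +-cancelʳ-≡ℤ)

count : ∀ {a p} {A : Set a} {P : Pred A p} → Decidable P → List A → ℕ
count P? [] = 0
count P? (x ∷ xs) with P? x
... | yes _ = suc (count P? xs)
... | no  _ = count P? xs

module _ {a p} {A : Set a} {P : Pred A p} (P? : Decidable P) where

  count-none : (∀ x → ¬ P x) → ∀ xs → count P? xs ≡ 0
  count-none ¬P [] = refl
  count-none ¬P (x ∷ xs) with P? x
  ... | yes px = contradiction px (¬P x)
  ... | no  _  = count-none ¬P xs

  count-all : (∀ x → P x) → ∀ xs → count P? xs ≡ length xs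
  count-all allP [] = refl
  count-all allP (x ∷ xs) with P? x
  ... | yes _  = cong suc (count-all allP xs)
  ... | no ¬px = contradiction (allP x) ¬px

  count-++ : ∀ xs ys → count P? (xs ++ ys) ≡ count P? xs + count P? ys
  count-++ [] ys = refl
  count-++ (x ∷ xs) ys with P? x
  ... | yes _ = cong suc (count-++ xs ys)
  ... | no  _ = count-++ xs ys

  count+count-∁ : ∀ xs → count P? xs + count (∁? P?) xs ≡ length xs
  count+count-∁ [] = refl
  count+count-∁ (x ∷ xs) with P? x
  ... | yes _  = cong suc (count+count-∁ xs)
  ... | no  _  = trans (+-suc (count P? xs) _) (cong suc (count+count-∁ xs))

  count-≤1 : ∀ {xs} → Unique xs → (∀ {x y} → P x → P y → x ≡ y) → count P? xs ≤ 1
  count-≤1 [] _ = z≤n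
  count-≤1 {x ∷ xs} (x∉xs ∷ uxs) P-unique with P? x
  ... | no  _  = count-≤1 uxs P-unique
  ... | yes px = s≤s (≤-reflexive (count-none-after x∉xs))
    where
    count-none-after : ∀ {ys} → All (x ≢_) ys → count P? ys ≡ 0
    count-none-after [] = refl
    count-none-after {y ∷ ys} (x≢y ∷ x≢ys) with P? y
    ... | yes py = contradiction (P-unique px py) x≢y
    ... | no  _  = count-none-after x≢ys

module _ {a p q} {A : Set a} {P : Pred A p} {Q : Pred A q} (P? : Decidable P) (Q? : Decidable Q) where

  count-mono : P ⊆ Q → ∀ xs → count P? xs ≤ count Q? xs
  count-mono P⊆Q [] = z≤n
  count-mono P⊆Q (x ∷ xs) with P? x | Q? x
  ... | yes _  | yes _  = s≤s (count-mono P⊆Q xs)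
  ... | yes px | no ¬qx = contradiction (P⊆Q px) ¬qx
  ... | no  _  | yes _  = m≤n⇒m≤1+n (count-mono P⊆Q xs)
  ... | no  _  | no  _  = count-mono P⊆Q xs

  count-∪ : ∀ xs → count (P? ∪? Q?) xs ≤ count P? xs + count Q? xs
  count-∪ [] = z≤n
  count-∪ (x ∷ xs) with P? x | Q? x
  ... | yes _ | yes _ = s≤s (≤-trans (count-∪ xs) (+-monoʳ-≤ (count P? xs) (n≤1+n _)))
  ... | yes _ | no  _ = s≤s (count-∪ xs)
  ... | no  _ | yes _ = ≤-trans (s≤s (count-∪ xs)) (≤-reflexive (sym (+-suc _ _)))
  ... | no  _ | no  _ = count-∪ xs

module _ {a b p q} {A : Set a} {B : Set b} {P : Pred A p} {Q : Pred B q}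
         (P? : Decidable P) (Q? : Decidable Q) where

  count-cartesianProduct : ∀ xs ys →
    count (P? ×? Q?) (cartesianProduct xs ys) ≡ count P? xs * count Q? ys
  count-cartesianProduct [] ys = refl
  count-cartesianProduct (x ∷ xs) ys = begin
      count (P? ×? Q?) (map (x ,_) ys ++ cartesianProduct xs ys)
    ≡⟨ count-++ (P? ×? Q?) (map (x ,_) ys) _ ⟩
      count (P? ×? Q?) (map (x ,_) ys) + count (P? ×? Q?) (cartesianProduct xs ys)
    ≡⟨ cong₂ _+_ count-row (count-cartesianProduct xs ys) ⟩
      count P? (x ∷ []) * count Q? ys + count P? xs * count Q? ys
    ≡⟨ sym (*-distribʳ-+ (count Q? ys) (count P? (x ∷ [])) _) ⟩
      (count P? (x ∷ []) + count P? xs) * count Q? ys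
    ≡⟨ cong (_* count Q? ys) (sym (count-++ P? (x ∷ []) xs)) ⟩
      count P? (x ∷ xs) * count Q? ys ∎
    where
    open ≡-Reasoning
    fibre-yes : P x → ∀ ys → count (P? ×? Q?) (map (x ,_) ys) ≡ count Q? ys
    fibre-yes px [] = refl
    fibre-yes px (y ∷ ys) with P? x | Q? y
    ... | yes _  | yes _ = cong suc (fibre-yes px ys)
    ... | yes _  | no  _ = fibre-yes px ys
    ... | no ¬px | _     = contradiction px ¬px

    fibre-no : ¬ P x → ∀ ys → count (P? ×? Q?) (map (x ,_) ys) ≡ 0
    fibre-no ¬px [] = refl
    fibre-no ¬px (y ∷ ys) with P? x
    ... | yes px = contradiction px ¬px
    ... | no  _  = fibre-no ¬px ys

    count-row : count (P? ×? Q?) (map (x ,_) ys) ≡ count P? (x ∷ []) * count Q? ys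
    count-row with P? x
    ... | yes px = trans (fibre-yes px ys) (sym (+-identityʳ _))
    ... | no ¬px = fibre-no ¬px ys

Window : ℕ → ℕ → Pred ℕ _
Window lo w v = lo ≤ v × v < lo + w

window? : ∀ lo w → Decidable (Window lo w)
window? lo w v = lo ≤? v ×-dec v <? lo + w

count-window : ∀ {a} {A : Set a} {g : A → ℕ} → Injective _≡_ _≡_ g →
               ∀ {xs} → Unique xs → ∀ lo w → count (window? lo w ∘ g) xs ≤ w
count-window {g = g} g-injective {xs} uxs lo zero = ≤-reflexive (count-none (window? lo 0 ∘ g) empty xs)
  where
  empty : ∀ x → ¬ Window lo 0 (g x)
  empty x (lo≤ , <lo+0) = ≤⇒≯ lo≤ (subst (g x <_) (+-identityʳ lo) <lo+0)
count-window {g = g} g-injective {xs} uxs lo (suc w) = begin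
    count (window? lo (suc w) ∘ g) xs
  ≤⟨ count-mono (window? lo (suc w) ∘ g) (at? ∪? (window? (suc lo) w ∘ g)) split xs ⟩
    count (at? ∪? (window? (suc lo) w ∘ g)) xs
  ≤⟨ count-∪ at? (window? (suc lo) w ∘ g) xs ⟩
    count at? xs + count (window? (suc lo) w ∘ g) xs
  ≤⟨ +-mono-≤ (count-≤1 at? uxs (λ gx≡lo gy≡lo → g-injective (trans gx≡lo (sym gy≡lo))))
              (count-window g-injective uxs (suc lo) w) ⟩
    suc w ∎
  where
  open ≤-Reasoning
  at? : Decidable (λ x → g x ≡ lo)
  at? x = g x ≟ lo
  split : Window lo (suc w) ∘ g ⊆ (λ x → g x ≡ lo) ∪ (Window (suc lo) w ∘ g)
  split {x} (lo≤ , <lo+1+w) with m≤n⇒m<n∨m≡n lo≤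
  ... | inj₁ lo< = inj₂ (lo< , subst (g x <_) (+-suc lo w) <lo+1+w)
  ... | inj₂ lo≡ = inj₁ (sym lo≡)

length-cartesianProduct : ∀ {a b} {A : Set a} {B : Set b} (xs : List A) (ys : List B) →
                          length (cartesianProduct xs ys) ≡ length xs * length ys
length-cartesianProduct xs ys = begin
  length (cartesianProduct xs ys)         ≡⟨ sym (count-all (U? ×? U?) _ (cartesianProduct xs ys)) ⟩
  count (U? ×? U?) (cartesianProduct xs ys) ≡⟨ count-cartesianProduct U? U? xs ys ⟩
  count U? xs * count U? ys               ≡⟨ cong₂ _*_ (count-all U? _ xs) (count-all U? _ ys) ⟩
  length xs * length ys                   ∎
  where open ≡-Reasoning

max-∈ : ∀ {a} {A : Set a} (h : A → ℕ) {x xs} → x ∈ xs → h x ≤ foldr _⊔_ 0 (map h xs)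
max-∈ h (here refl) = m≤m⊔n _ _
max-∈ h {xs = y ∷ _} (there x∈xs) = ≤-trans (max-∈ h x∈xs) (m≤n⊔m (h y) _)

∈-allEdges : ∀ {n} (e : Edge n) → e ∈ allEdges n
∈-allEdges (i , j) = ∈-cartesianProduct⁺ (∈-allFin i) (∈-allFin j)

length-allFin : ∀ n → length (allFin n) ≡ n
length-allFin n = length-tabulate {n = n} (λ i → i)

length-allEdges : ∀ n → length (allEdges n) ≡ n * n
length-allEdges n = trans (length-cartesianProduct (allFin n) (allFin n))
                          (cong₂ _*_ (length-allFin n) (length-allFin n))

max≤ : ∀ {a} {A : Set a} (h : A → ℕ) {K} → (∀ x → h x ≤ K) → ∀ xs → foldr _⊔_ 0 (map h xs) ≤ K
max≤ h h≤K [] = z≤n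
max≤ h h≤K (x ∷ xs) = ⊔-lub (h≤K x) (max≤ h h≤K xs)

∣f-f∣≤B'f : ∀ {n} (F : EdgeNumbering n) {e e'} → IncidentDistinct e e' → ∣ proj₁ F e ℤ.- proj₁ F e' ∣ ≤ B'f F
∣f-f∣≤B'f {n} (f , _) {e} {e'} incident = subst (_≤ _) (pairCost-incident incident)
  (max-∈ (pairCost f) (∈-cartesianProduct⁺ (∈-allEdges e) (∈-allEdges e')))
  where
  pairCost-incident : IncidentDistinct e e' → pairCost f (e , e') ≡ ∣ f e ℤ.- f e' ∣
  pairCost-incident incident with incidentDistinct? e e'
  ... | yes _ = refl
  ... | no ¬incident = contradiction incident ¬incident

B'f≤ : ∀ {n} (F : EdgeNumbering n) {K} →
       (∀ {e e'} → IncidentDistinct e e' → ∣ proj₁ F e ℤ.- proj₁ F e' ∣ ≤ K) → B'f F ≤ K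
B'f≤ {n} (f , _) {K} close = max≤ (pairCost f) bounded (cartesianProduct (allEdges n) (allEdges n))
  where
  bounded : ∀ p → pairCost f p ≤ K
  bounded (e , e') with incidentDistinct? e e'
  ... | yes incident = close incident
  ... | no  _        = z≤n

2*[1+n]C2≡n*[1+n] : ∀ n → 2 * (suc n C 2) ≡ n * suc n
2*[1+n]C2≡n*[1+n] zero = refl
2*[1+n]C2≡n*[1+n] (suc n) = begin
    2 * (suc (suc n) C 2)               ≡⟨ cong (2 *_) (sym (nCk+nC[k+1]≡[n+1]C[k+1] (suc n) 1)) ⟩
    2 * (suc n C 1 + suc n C 2)         ≡⟨ cong (λ c → 2 * (c + suc n C 2)) (nC1≡n (suc n)) ⟩
    2 * (suc n + suc n C 2)             ≡⟨ *-distribˡ-+ 2 (suc n) _ ⟩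
    2 * suc n + 2 * (suc n C 2)         ≡⟨ cong (λ c → 2 * suc n + c) (2*[1+n]C2≡n*[1+n] n) ⟩
    2 * suc n + n * suc n               ≡⟨ sym (*-distribʳ-+ (suc n) 2 n) ⟩
    suc (suc n) * suc n                 ≡⟨ *-comm (suc (suc n)) (suc n) ⟩
    suc n * suc (suc n)                 ∎
  where open ≡-Reasoning

-- The lower bound

crossing : ∀ {p} {P : Pred ℕ p} → Decidable P → ¬ P 0 → ∀ {k} → P k → ∃[ t ] ¬ P t × P (suc t)
crossing P? ¬P0 {zero} P0 = contradiction P0 ¬P0
crossing P? ¬P0 {suc k} Pk+1 with P? k
... | yes Pk = crossing P? ¬P0 Pk
... | no ¬Pk = k , ¬Pk , Pk+1

complements-small : ∀ {n a a' b b'} → a + a' ≡ n → b + b' ≡ n → suc n ≤ a + b → a' + b' < n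
complements-small {n} {a} {a'} {b} {b'} a+a'≡n b+b'≡n n<a+b = +-cancelˡ-< n (a' + b') n (begin-strict
    n + (a' + b')         <⟨ +-monoˡ-< (a' + b') n<a+b ⟩
    (a + b) + (a' + b')   ≡⟨ interchange a b a' b' ⟩
    (a + a') + (b + b')   ≡⟨ cong₂ _+_ a+a'≡n b+b'≡n ⟩
    n + n                 ∎)
  where
  open ≤-Reasoning
  interchange : ∀ a b a' b' → (a + b) + (a' + b') ≡ (a + a') + (b + b')
  interchange = solve-∀

4*m*n≤[m+n]² : ∀ m n → 4 * (m * n) ≤ (m + n) * (m + n)
4*m*n≤[m+n]² m n = [ ordered , swapped ]′ (≤-total m n)
  where
  square : ∀ m d → 4 * (m * (m + d)) + d * d ≡ (m + (m + d)) * (m + (m + d))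
  square = solve-∀
  ordered : ∀ {m n} → m ≤ n → 4 * (m * n) ≤ (m + n) * (m + n)
  ordered {m} {n} m≤n = subst (λ n → 4 * (m * n) ≤ (m + n) * (m + n)) (m+[n∸m]≡n m≤n)
                          (≤-trans (m≤m+n _ _) (≤-reflexive (square m (n ∸ m))))
  swapped : n ≤ m → 4 * (m * n) ≤ (m + n) * (m + n)
  swapped n≤m = subst₂ _≤_ (cong (4 *_) (*-comm n m)) (cong (λ r → r * r) (+-comm n m)) (ordered n≤m)

4*m≤4*n+1⇒m≤n : ∀ {m n} → 4 * m ≤ 4 * n + 1 → m ≤ n
4*m≤4*n+1⇒m≤n {m} {n} le = <⇒≤pred (*-cancelˡ-< 4 m (suc n) (begin-strict
    4 * m       ≤⟨ le ⟩
    4 * n + 1   <⟨ +-monoʳ-< (4 * n) (s≤s (s≤s z≤n)) ⟩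
    4 * n + 4   ≡⟨ +-comm (4 * n) 4 ⟩
    4 + 4 * n   ≡⟨ sym (*-suc 4 n) ⟩
    4 * suc n   ∎))
  where open ≤-Reasoning

-- The count behind the lower bound on a grid of size n = 1 + m: s edges lie below the
-- threshold, bd on its boundary and at most a' * b' are untouched by it; c and d are
-- the numbers of rows and columns met one step earlier.
edge-count-bound : ∀ {m k s bd a' b' c d} → 2 * k ≡ suc m * suc (suc m) →
  c + d ≤ suc m → s ≤ suc (c * d) → a' + b' ≤ m →
  suc m * suc m ≤ s + bd + a' * b' → k ≤ suc bd
edge-count-bound {m} {k} {s} {bd} {a'} {b'} {c} {d} 2k≡ c+d≤ s≤ a'+b'≤ n²≤ =
  4*m≤4*n+1⇒m≤n (+-cancelʳ-≤ (n * n + m * m) (4 * k) (4 * suc bd + 1) (begin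
    4 * k + (n * n + m * m)                 ≡⟨ cong (_+ (n * n + m * m)) (4*k≡2*[2*k] k) ⟩
    2 * (2 * k) + (n * n + m * m)           ≡⟨ cong (λ r → 2 * r + (n * n + m * m)) 2k≡ ⟩
    2 * (n * suc n) + (n * n + m * m)       ≡⟨ four-squares m ⟩
    4 * (n * n) + 1                         ≤⟨ +-monoˡ-≤ 1 (*-monoʳ-≤ 4 n²≤) ⟩
    4 * (s + bd + a' * b') + 1              ≡⟨ expand s bd (a' * b') ⟩
    4 * s + 4 * bd + 4 * (a' * b') + 1      ≤⟨ +-monoˡ-≤ 1 (+-mono-≤ (+-monoˡ-≤ (4 * bd) 4s≤) 4a'b'≤) ⟩
    4 + n * n + 4 * bd + m * m + 1          ≡⟨ regroup (n * n) bd (m * m) ⟩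
    4 * suc bd + 1 + (n * n + m * m)        ∎))
  where
  open ≤-Reasoning
  n = suc m
  4*k≡2*[2*k] : ∀ k → 4 * k ≡ 2 * (2 * k)
  4*k≡2*[2*k] = solve-∀
  four-squares : ∀ m → 2 * (suc m * suc (suc m)) + (suc m * suc m + m * m) ≡ 4 * (suc m * suc m) + 1
  four-squares = solve-∀
  expand : ∀ x y z → 4 * (x + y + z) + 1 ≡ 4 * x + 4 * y + 4 * z + 1
  expand = solve-∀
  regroup : ∀ x y z → 4 + x + 4 * y + z + 1 ≡ 4 * suc y + 1 + (x + z)
  regroup = solve-∀
  4s≤ : 4 * s ≤ 4 + n * n
  4s≤ = begin
    4 * s                 ≤⟨ *-monoʳ-≤ 4 s≤ ⟩
    4 * suc (c * d)       ≡⟨ *-suc 4 (c * d) ⟩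
    4 + 4 * (c * d)       ≤⟨ +-monoʳ-≤ 4 (≤-trans (4*m*n≤[m+n]² c d) (*-mono-≤ c+d≤ c+d≤)) ⟩
    4 + n * n             ∎
  4a'b'≤ : 4 * (a' * b') ≤ m * m
  4a'b'≤ = ≤-trans (4*m*n≤[m+n]² a' b') (*-mono-≤ a'+b'≤ a'+b'≤)

module LowerBound {m : ℕ} (g : Edge (suc m) → ℕ) (g-injective : Injective _≡_ _≡_ g)
                  (B : ℕ) (g-close : ∀ {e e'} → IncidentDistinct e e' → g e ≤ g e' + B) where

  private
    n = suc m
    vertices = allFin n
    edges = allEdges n
    uniqueEdges : Unique edges
    uniqueEdges = cartesianProduct⁺ (allFin⁺ n) (allFin⁺ n)

  Below : ℕ → Pred (Edge n) _
  Below t e = g e < t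

  below? : ∀ t → Decidable (Below t)
  below? t e = g e <? t

  RowMeets ColMeets : ℕ → Pred (Fin n) _
  RowMeets t i = ∃[ j ] Below t (i , j)
  ColMeets t j = ∃[ i ] Below t (i , j)

  rowMeets? : ∀ t → Decidable (RowMeets t)
  rowMeets? t i = any? (λ j → below? t (i , j))

  colMeets? : ∀ t → Decidable (ColMeets t)
  colMeets? t j = any? (λ i → below? t (i , j))

  Touched : ℕ → Pred (Edge n) _
  Touched t (i , j) = RowMeets t i ⊎ ColMeets t j

  touched? : ∀ t → Decidable (Touched t)
  touched? t (i , j) = rowMeets? t i ⊎-dec colMeets? t j

  Boundary : ℕ → Pred (Edge n) _
  Boundary t = ∁ (Below t) ∩ Touched t

  boundary? : ∀ t → Decidable (Boundary t)
  boundary? t = ∁? (below? t) ∩? touched? t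

  rowsMet colsMet rowsMissed colsMissed : ℕ → ℕ
  rowsMet t = count (rowMeets? t) vertices
  colsMet t = count (colMeets? t) vertices
  rowsMissed t = count (∁? (rowMeets? t)) vertices
  colsMissed t = count (∁? (colMeets? t)) vertices

  count-below : ∀ t → count (below? t) edges ≤ rowsMet t * colsMet t
  count-below t = ≤-trans
    (count-mono (below? t) (rowMeets? t ×? colMeets? t) (λ {(i , j)} gij<t → (j , gij<t) , (i , gij<t)) edges)
    (≤-reflexive (count-cartesianProduct (rowMeets? t) (colMeets? t) vertices vertices))

  count-untouched : ∀ t → count (∁? (touched? t)) edges ≤ rowsMissed t * colsMissed t
  count-untouched t = ≤-trans
    (count-mono (∁? (touched? t)) (∁? (rowMeets? t) ×? ∁? (colMeets? t))
                (λ ¬touched → ¬touched ∘ inj₁ , ¬touched ∘ inj₂) edges)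
    (≤-reflexive (count-cartesianProduct (∁? (rowMeets? t)) (∁? (colMeets? t)) vertices vertices))

  count-edges : ∀ t → n * n ≤ count (below? t) edges + count (boundary? t) edges + count (∁? (touched? t)) edges
  count-edges t = begin
      n * n
    ≡⟨ sym (length-allEdges n) ⟩
      length edges
    ≡⟨ sym (count-all (below? t ∪? (boundary? t ∪? ∁? (touched? t))) trichotomy edges) ⟩
      count (below? t ∪? (boundary? t ∪? ∁? (touched? t))) edges
    ≤⟨ count-∪ (below? t) _ edges ⟩
      count (below? t) edges + count (boundary? t ∪? ∁? (touched? t)) edges
    ≤⟨ +-monoʳ-≤ (count (below? t) edges) (count-∪ (boundary? t) (∁? (touched? t)) edges) ⟩
      count (below? t) edges + (count (boundary? t) edges + count (∁? (touched? t)) edges)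
    ≡⟨ sym (+-assoc (count (below? t) edges) _ _) ⟩
      count (below? t) edges + count (boundary? t) edges + count (∁? (touched? t)) edges ∎
    where
    open ≤-Reasoning
    trichotomy : ∀ e → (Below t ∪ (Boundary t ∪ ∁ (Touched t))) e
    trichotomy e with below? t e | touched? t e
    ... | yes below | _          = inj₁ below
    ... | no ¬below | yes touched = inj₂ (inj₁ (¬below , touched))
    ... | no _      | no ¬touched = inj₂ (inj₂ ¬touched)

  count-below-suc : ∀ t → count (below? (suc t)) edges ≤ suc (count (below? t) edges)
  count-below-suc t = begin
      count (below? (suc t)) edges
    ≤⟨ count-mono (below? (suc t)) (below? t ∪? (window? t 1 ∘ g)) split edges ⟩
      count (below? t ∪? (window? t 1 ∘ g)) edges
    ≤⟨ count-∪ (below? t) (window? t 1 ∘ g) edges ⟩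
      count (below? t) edges + count (window? t 1 ∘ g) edges
    ≤⟨ +-monoʳ-≤ (count (below? t) edges) (count-window g-injective uniqueEdges t 1) ⟩
      count (below? t) edges + 1
    ≡⟨ +-comm _ 1 ⟩
      suc (count (below? t) edges) ∎
    where
    open ≤-Reasoning
    split : Below (suc t) ⊆ Below t ∪ (Window t 1 ∘ g)
    split {e} ge≤t with m≤n⇒m<n∨m≡n (s≤s⁻¹ ge≤t)
    ... | inj₁ ge<t = inj₁ ge<t
    ... | inj₂ ge≡t = inj₂ (≤-reflexive (sym ge≡t) , subst (g e <_) (+-comm 1 t) (s≤s (≤-reflexive ge≡t)))

  -- A boundary edge is incident to an edge numbered below the threshold, so its own
  -- number lies less than B above the threshold.
  count-boundary : ∀ t → count (boundary? (suc t)) edges ≤ B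
  count-boundary t = ≤-trans
    (count-mono (boundary? (suc t)) (window? (suc t) B ∘ g) in-window edges)
    (count-window g-injective uniqueEdges (suc t) B)
    where
    near : ∀ {e e'} → ¬ Below (suc t) e → Below (suc t) e' →
           proj₁ e ≡ proj₁ e' ⊎ proj₂ e ≡ proj₂ e' → g e < suc t + B
    near {e} {e'} ¬below below' shared =
      ≤-<-trans (g-close ((λ e≡e' → ¬below (subst (Below (suc t)) (sym e≡e') below')) , shared))
                (+-monoˡ-< B below')
    in-window : Boundary (suc t) ⊆ Window (suc t) B ∘ g
    in-window {i , j} (¬below , inj₁ (j' , below')) = ≮⇒≥ ¬below , near ¬below below' (inj₁ refl)
    in-window {i , j} (¬below , inj₂ (i' , below')) = ≮⇒≥ ¬below , near ¬below below' (inj₂ refl)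

  Crowded : Pred ℕ _
  Crowded t = suc n ≤ rowsMet t + colsMet t

  crowded? : Decidable Crowded
  crowded? t = suc n ≤? rowsMet t + colsMet t

  ¬crowded-0 : ¬ Crowded 0
  ¬crowded-0 crowded = contradiction (≤-trans crowded (≤-reflexive (cong₂ _+_ rows0 cols0))) λ ()
    where
    rows0 : rowsMet 0 ≡ 0
    rows0 = count-none (rowMeets? 0) (λ _ (_ , g<0) → n≮0 g<0) vertices
    cols0 : colsMet 0 ≡ 0
    cols0 = count-none (colMeets? 0) (λ _ (_ , g<0) → n≮0 g<0) vertices

  top : ℕ
  top = suc (foldr _⊔_ 0 (map g edges))

  crowded-top : Crowded top
  crowded-top = ≤-trans (≤-trans (≤-reflexive (+-comm 1 n)) (+-monoʳ-≤ n (s≤s z≤n)))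
                        (≤-reflexive (sym (cong₂ _+_ allRows allCols)))
    where
    below-top : ∀ e → Below top e
    below-top e = s≤s (max-∈ g (∈-allEdges e))
    allRows : rowsMet top ≡ n
    allRows = trans (count-all (rowMeets? top) (λ i → Fin.zero , below-top (i , Fin.zero)) vertices) (length-allFin n)
    allCols : colsMet top ≡ n
    allCols = trans (count-all (colMeets? top) (λ j → Fin.zero , below-top (Fin.zero , j)) vertices) (length-allFin n)

  missed-small : ∀ {t} → Crowded t → rowsMissed t + colsMissed t ≤ m
  missed-small {t} crowded = s≤s⁻¹ (complements-small {a = rowsMet t} {b = colsMet t}
    (trans (count+count-∁ (rowMeets? t) vertices) (length-allFin n))
    (trans (count+count-∁ (colMeets? t) vertices) (length-allFin n)) crowded)

  lowerBound : ∀ {k} → 2 * k ≡ n * suc n → k ≤ suc B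
  lowerBound 2k≡ with crossing crowded? ¬crowded-0 {top} crowded-top
  ... | t , ¬crowded , crowded = ≤-trans
    (edge-count-bound {s = below} {bd = boundary} {a' = rowsMissed (suc t)} {b' = colsMissed (suc t)}
                      {c = rowsMet t} {d = colsMet t}
                      2k≡ (s≤s⁻¹ (≰⇒> ¬crowded)) below≤ (missed-small {suc t} crowded) edges≤)
    (s≤s (count-boundary t))
    where
    below boundary : ℕ
    below = count (below? (suc t)) edges
    boundary = count (boundary? (suc t)) edges
    below≤ : below ≤ suc (rowsMet t * colsMet t)
    below≤ = ≤-trans (count-below-suc t) (s≤s (count-below t))
    edges≤ : n * n ≤ below + boundary + rowsMissed (suc t) * colsMissed (suc t)
    edges≤ = ≤-trans (count-edges (suc t)) (+-monoʳ-≤ (below + boundary) (count-untouched (suc t)))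

∣i∣≤m⇒0≤i+m : ∀ {i m} → ∣ i ∣ ≤ m → 0ℤ ℤ.≤ i ℤ.+ + m
∣i∣≤m⇒0≤i+m {+ k} _ = ℤ.+≤+ z≤n
∣i∣≤m⇒0≤i+m { -[1+ k ]} k<m = subst (0ℤ ℤ.≤_) (sym (ℤ.⊖-≥ k<m)) (ℤ.+≤+ z≤n)

-- Shifting the numbers by the largest absolute value makes them natural numbers
-- without changing any difference.
B'f-lowerBound : ∀ {m} (F : EdgeNumbering (suc m)) → suc (suc m) C 2 ∸ 1 ≤ B'f F
B'f-lowerBound {m} F@(f , f-injective) =
  ∸-monoˡ-≤ 1 (LowerBound.lowerBound g g-injective (B'f F) g-close {suc (suc m) C 2} (2*[1+n]C2≡n*[1+n] (suc m)))
  where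
  M : ℕ
  M = foldr _⊔_ 0 (map (∣_∣ ∘ f) (allEdges (suc m)))
  g : Edge (suc m) → ℕ
  g e = ∣ f e ℤ.+ + M ∣
  +g≡f+M : ∀ e → + g e ≡ f e ℤ.+ + M
  +g≡f+M e = ℤ.0≤i⇒+∣i∣≡i (∣i∣≤m⇒0≤i+m {f e} (max-∈ (∣_∣ ∘ f) (∈-allEdges e)))
  g-injective : Injective _≡_ _≡_ g
  g-injective {e} {e'} ge≡ge' = f-injective (+-cancelʳ-≡ℤ (+ M) (f e) (f e')
    (trans (sym (+g≡f+M e)) (trans (cong +_ ge≡ge') (+g≡f+M e'))))
  g-close : ∀ {e e'} → IncidentDistinct e e' → g e ≤ g e' + B'f F
  g-close {e} {e'} incident = begin
    ∣ f e ℤ.+ + M ∣                              ≡⟨ cong ∣_∣ (telescope (f e) (f e') (+ M)) ⟩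
    ∣ (f e ℤ.- f e') ℤ.+ (f e' ℤ.+ + M) ∣        ≤⟨ ℤ.∣i+j∣≤∣i∣+∣j∣ (f e ℤ.- f e') _ ⟩
    ∣ f e ℤ.- f e' ∣ + g e'                      ≤⟨ +-monoˡ-≤ (g e') (∣f-f∣≤B'f F incident) ⟩
    B'f F + g e'                                 ≡⟨ +-comm (B'f F) (g e') ⟩
    g e' + B'f F                                 ∎
    where
    open ≤-Reasoning
    telescope : ∀ i j k → i ℤ.+ k ≡ (i ℤ.- j) ℤ.+ (j ℤ.+ k)
    telescope = ℤ-Solver.solve-∀

-- The shell numbering

-- The staircase {(x , y) | x + y < m} is cut into shells: shell k is the row arm
-- (k , y) with y < k, followed by the column arm (x , k) with x ≤ k.
rowArm colArm : ℕ → ℕ → ℕ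
rowArm m k = k ⊓ (m ∸ k)
colArm m k = suc k ⊓ (m ∸ k)

shellStart : ℕ → ℕ → ℕ
shellStart m zero = 0
shellStart m (suc k) = shellStart m k + rowArm m k + colArm m k

shellOrder : ℕ → ℕ → ℕ → ℕ
shellOrder m x y with y <? x
... | yes _ = shellStart m x + y
... | no  _ = shellStart m y + rowArm m y + x

module _ {m : ℕ} where

  shellStart-mono : ∀ {k l} → k ≤ l → shellStart m k ≤ shellStart m l
  shellStart-mono {l = zero} z≤n = ≤-refl
  shellStart-mono {k} {suc l} k≤1+l with m≤n⇒m<n∨m≡n k≤1+l
  ... | inj₁ k<1+l = ≤-trans (shellStart-mono (s≤s⁻¹ k<1+l)) (≤-trans (m≤m+n _ _) (m≤m+n _ _))
  ... | inj₂ refl = ≤-refl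

  InRowArm InColArm InShell : ℕ → ℕ → Set
  InRowArm k v = shellStart m k ≤ v × v < shellStart m k + rowArm m k
  InColArm k v = shellStart m k + rowArm m k ≤ v × v < shellStart m (suc k)
  InShell  k v = shellStart m k ≤ v × v < shellStart m (suc k)

  rowArm⇒shell : ∀ {k v} → InRowArm k v → InShell k v
  rowArm⇒shell (lo , hi) = lo , <-≤-trans hi (m≤m+n _ _)

  colArm⇒shell : ∀ {k v} → InColArm k v → InShell k v
  colArm⇒shell (lo , hi) = ≤-trans (m≤m+n _ _) lo , hi

  shell-unique : ∀ {k l v} → InShell k v → InShell l v → k ≡ l
  shell-unique {k} {l} (lo , hi) (lo' , hi') with <-cmp k l
  ... | tri≈ _ k≡l _ = k≡l
  ... | tri< k<l _ _ = contradiction (<-≤-trans hi (≤-trans (shellStart-mono k<l) lo')) (<-irrefl refl)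
  ... | tri> _ _ l<k = contradiction (<-≤-trans hi' (≤-trans (shellStart-mono l<k) lo)) (<-irrefl refl)

  rowArm-colArm-disjoint : ∀ {k l v} → InRowArm k v → InColArm l v → ⊥
  rowArm-colArm-disjoint {k} {l} {v} row col
    with shell-unique {k} {l} (rowArm⇒shell {k} {v} row) (colArm⇒shell {l} {v} col)
  ... | refl = <-irrefl refl (<-≤-trans (proj₂ row) (proj₁ col))

  shellOrder-row : ∀ {x y} → y < x → shellOrder m x y ≡ shellStart m x + y
  shellOrder-row {x} {y} y<x with y <? x
  ... | yes _   = refl
  ... | no y≮x = contradiction y<x y≮x

  shellOrder-col : ∀ {x y} → ¬ y < x → shellOrder m x y ≡ shellStart m y + rowArm m y + x
  shellOrder-col {x} {y} y≮x with y <? x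
  ... | yes y<x = contradiction y<x y≮x
  ... | no _    = refl

  private
    y<m∸x : ∀ {x y} → x + y < m → y < m ∸ x
    y<m∸x {x} {y} x+y<m = m+n≤o⇒m≤o∸n (suc y) (subst (_≤ m) (cong suc (+-comm x y)) x+y<m)

  shellOrder-inRowArm : ∀ {x y} → y < x → x + y < m → InRowArm x (shellOrder m x y)
  shellOrder-inRowArm {x} {y} y<x x+y<m rewrite shellOrder-row y<x =
    m≤m+n _ _ , +-monoʳ-< (shellStart m x) (⊓-glb y<x (y<m∸x x+y<m))

  shellOrder-inColArm : ∀ {x y} → ¬ y < x → x + y < m → InColArm y (shellOrder m x y)
  shellOrder-inColArm {x} {y} y≮x x+y<m rewrite shellOrder-col y≮x =
    m≤m+n _ _ , +-monoʳ-< (shellStart m y + rowArm m y)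
                          (⊓-glb (s≤s (≮⇒≥ y≮x)) (y<m∸x (subst (_< m) (+-comm x y) x+y<m)))

  shellOrder-position : ∀ x y → x + y < m →
    InRowArm x (shellOrder m x y) × y < x ⊎ InColArm y (shellOrder m x y) × x ≤ y
  shellOrder-position x y x+y<m = by-cases (y <? x)
    where
    by-cases : Dec (y < x) → InRowArm x (shellOrder m x y) × y < x ⊎ InColArm y (shellOrder m x y) × x ≤ y
    by-cases (yes y<x) = inj₁ (shellOrder-inRowArm y<x x+y<m , y<x)
    by-cases (no y≮x)  = inj₂ (shellOrder-inColArm y≮x x+y<m , ≮⇒≥ y≮x)

  shellOrder-injective : ∀ {x y x' y'} → x + y < m → x' + y' < m →
                         shellOrder m x y ≡ shellOrder m x' y' → x ≡ x' × y ≡ y'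
  shellOrder-injective {x} {y} {x'} {y'} x+y<m x'+y'<m eq
    with shellOrder-position x y x+y<m | shellOrder-position x' y' x'+y'<m
  ... | inj₁ (row , y<x) | inj₁ (row' , y'<x') = x≡x' , +-cancelˡ-≡ (shellStart m x) y y' (begin
      shellStart m x + y    ≡⟨ sym (shellOrder-row y<x) ⟩
      shellOrder m x y      ≡⟨ eq ⟩
      shellOrder m x' y'    ≡⟨ shellOrder-row y'<x' ⟩
      shellStart m x' + y'  ≡⟨ cong (λ k → shellStart m k + y') (sym x≡x') ⟩
      shellStart m x + y'   ∎)
    where
    open ≡-Reasoning
    x≡x' : x ≡ x'
    x≡x' = shell-unique (rowArm⇒shell {x} row) (rowArm⇒shell {x'} (subst (InRowArm x') (sym eq) row'))
  ... | inj₂ (col , x≤y) | inj₂ (col' , x'≤y') = +-cancelˡ-≡ (shellStart m y + rowArm m y) x x' (begin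
      shellStart m y + rowArm m y + x     ≡⟨ sym (shellOrder-col (≤⇒≯ x≤y)) ⟩
      shellOrder m x y                    ≡⟨ eq ⟩
      shellOrder m x' y'                  ≡⟨ shellOrder-col (≤⇒≯ x'≤y') ⟩
      shellStart m y' + rowArm m y' + x'  ≡⟨ cong (λ k → shellStart m k + rowArm m k + x') (sym y≡y') ⟩
      shellStart m y + rowArm m y + x'    ∎) , y≡y'
    where
    open ≡-Reasoning
    y≡y' : y ≡ y'
    y≡y' = shell-unique (colArm⇒shell {y} col) (colArm⇒shell {y'} (subst (InColArm y') (sym eq) col'))
  ... | inj₁ (row , _) | inj₂ (col' , _) = ⊥-elim (rowArm-colArm-disjoint {x} {y'} row (subst (InColArm y') (sym eq) col'))
  ... | inj₂ (col , _) | inj₁ (row' , _) = ⊥-elim (rowArm-colArm-disjoint {x'} {y} row' (subst (InColArm y) eq col))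

  shellOrder-< : ∀ x y → x + y < m → shellOrder m x y < shellStart m m
  shellOrder-< x y x+y<m with shellOrder-position x y x+y<m
  ... | inj₁ ((_ , o<) , _) = <-≤-trans (<-≤-trans o< (m≤m+n _ _)) (shellStart-mono (≤-<-trans (m≤m+n x y) x+y<m))
  ... | inj₂ ((_ , o<) , _) = <-≤-trans o< (shellStart-mono (≤-<-trans (m≤n+m y x) x+y<m))

  shellStart≤shellOrder : ∀ x y → shellStart m x ≤ shellOrder m x y
  shellStart≤shellOrder x y with y <? x
  ... | yes _   = m≤m+n _ _
  ... | no y≮x = ≤-trans (shellStart-mono (≮⇒≥ y≮x)) (≤-trans (m≤m+n _ _) (m≤m+n _ _))

  colArmStart≤shellOrder : ∀ x y → shellStart m y + rowArm m y ≤ shellOrder m x y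
  colArmStart≤shellOrder x y with y <? x
  ... | yes y<x = ≤-trans (m≤m+n _ _) (≤-trans (shellStart-mono y<x) (m≤m+n _ _))
  ... | no _    = m≤m+n _ _

  shellStart-square : ∀ {k} → k + k ≤ suc m → shellStart m k ≡ k * k
  shellStart-square {zero} _ = refl
  shellStart-square {suc k} 2k+2≤m+1 = begin
      shellStart m k + k ⊓ (m ∸ k) + suc k ⊓ (m ∸ k)
    ≡⟨ cong₂ (λ s r → s + r + suc k ⊓ (m ∸ k))
             (shellStart-square {k} 2k≤m+1) (m≤n⇒m⊓n≡m (≤-trans (n≤1+n k) 1+k≤m∸k)) ⟩
      k * k + k + suc k ⊓ (m ∸ k)
    ≡⟨ cong (λ c → k * k + k + c) (m≤n⇒m⊓n≡m 1+k≤m∸k) ⟩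
      k * k + k + suc k
    ≡⟨ next-square k ⟩
      suc k * suc k ∎
    where
    open ≡-Reasoning
    2k≤m+1 : k + k ≤ suc m
    2k≤m+1 = ≤-trans (+-mono-≤ (n≤1+n k) (n≤1+n k)) 2k+2≤m+1
    1+k≤m∸k : suc k ≤ m ∸ k
    1+k≤m∸k = m+n≤o⇒m≤o∸n (suc k) (subst (_≤ m) (+-comm k (suc k)) (s≤s⁻¹ 2k+2≤m+1))
    next-square : ∀ k → k * k + k + suc k ≡ suc k * suc k
    next-square = solve-∀

  shellStart-top : ∀ {r} → r + r ≤ m → shellStart m m ≡ shellStart m (m ∸ r) + r * suc r
  shellStart-top {zero} _ = sym (+-identityʳ (shellStart m m))
  shellStart-top {suc r} 2r+2≤m = begin
      shellStart m m
    ≡⟨ shellStart-top {r} (≤-trans (+-mono-≤ (n≤1+n r) (n≤1+n r)) 2r+2≤m) ⟩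
      shellStart m (m ∸ r) + r * suc r
    ≡⟨ cong (λ k → shellStart m k + r * suc r) m∸r≡1+j ⟩
      shellStart m j + j ⊓ (m ∸ j) + suc j ⊓ (m ∸ j) + r * suc r
    ≡⟨ cong (λ k → shellStart m j + j ⊓ k + suc j ⊓ k + r * suc r) (m∸[m∸n]≡n 1+r≤m) ⟩
      shellStart m j + j ⊓ suc r + suc j ⊓ suc r + r * suc r
    ≡⟨ cong₂ (λ a b → shellStart m j + a + b + r * suc r)
             (m≥n⇒m⊓n≡n 1+r≤j) (m≥n⇒m⊓n≡n (m≤n⇒m≤1+n 1+r≤j)) ⟩
      shellStart m j + suc r + suc r + r * suc r
    ≡⟨ next-pronic (shellStart m j) r ⟩
      shellStart m j + suc r * suc (suc r) ∎
    where
    open ≡-Reasoning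
    j = m ∸ suc r
    1+r≤j : suc r ≤ j
    1+r≤j = m+n≤o⇒m≤o∸n (suc r) 2r+2≤m
    1+r≤m : suc r ≤ m
    1+r≤m = ≤-trans (m≤m+n (suc r) (suc r)) 2r+2≤m
    m∸r≡1+j : m ∸ r ≡ suc j
    m∸r≡1+j = +-∸-assoc 1 1+r≤m
    next-pronic : ∀ s r → s + suc r + suc r + r * suc r ≡ s + suc r * suc (suc r)
    next-pronic = solve-∀

halve : ∀ m → ∃[ h ] (m ≡ h + h ⊎ m ≡ suc (h + h))
halve zero = 0 , inj₁ refl
halve (suc m) with halve m
... | h , inj₁ m≡2h   = h , inj₂ (cong suc m≡2h)
... | h , inj₂ m≡2h+1 = suc h , inj₁ (trans (cong suc m≡2h+1) (cong suc (sym (+-suc h h))))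

2*shellStart≡m*[1+m] : ∀ m → 2 * shellStart m m ≡ m * suc m
2*shellStart≡m*[1+m] m with halve m
... | h , inj₁ refl = begin
    2 * shellStart m m
  ≡⟨ cong (2 *_) (shellStart-top {m} {h} ≤-refl) ⟩
    2 * (shellStart m (m ∸ h) + h * suc h)
  ≡⟨ cong (λ k → 2 * (shellStart m k + h * suc h)) (m+n∸n≡m h h) ⟩
    2 * (shellStart m h + h * suc h)
  ≡⟨ cong (λ s → 2 * (s + h * suc h)) (shellStart-square {m} {h} (n≤1+n m)) ⟩
    2 * (h * h + h * suc h)
  ≡⟨ even h ⟩
    m * suc m ∎
  where
  open ≡-Reasoning
  even : ∀ h → 2 * (h * h + h * suc h) ≡ (h + h) * suc (h + h)
  even = solve-∀
... | h , inj₂ refl = begin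
    2 * shellStart m m
  ≡⟨ cong (2 *_) (shellStart-top {m} {h} (n≤1+n _)) ⟩
    2 * (shellStart m (m ∸ h) + h * suc h)
  ≡⟨ cong (λ k → 2 * (shellStart m k + h * suc h)) (trans (cong (_∸ h) (sym (+-suc h h))) (m+n∸m≡n h (suc h))) ⟩
    2 * (shellStart m (suc h) + h * suc h)
  ≡⟨ cong (λ s → 2 * (s + h * suc h)) (shellStart-square {m} {suc h} (s≤s (≤-reflexive (+-suc h h)))) ⟩
    2 * (suc h * suc h + h * suc h)
  ≡⟨ odd h ⟩
    m * suc m ∎
  where
  open ≡-Reasoning
  odd : ∀ h → 2 * (suc h * suc h + h * suc h) ≡ suc (h + h) * suc (suc (h + h))
  odd = solve-∀

-- This is what keeps a row or column through both halves of the shell numbering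
-- within a span of W.
shellStart-split : ∀ {m} x k → x + k ≡ m →
                   shellStart m m ≤ shellStart (suc m) x + shellStart m k + k ⊓ x
shellStart-split zero k refl = m≤m+n (shellStart k k) (k ⊓ 0)
shellStart-split {m} (suc x) k x+1+k≡m = begin
    shellStart m m
  ≤⟨ shellStart-split x (suc k) (trans (+-suc x k) x+1+k≡m) ⟩
    shellStart (suc m) x + (shellStart m k + k ⊓ (m ∸ k) + suc k ⊓ (m ∸ k)) + suc k ⊓ x
  ≡⟨ cong (λ d → shellStart (suc m) x + (shellStart m k + k ⊓ d + suc k ⊓ d) + suc k ⊓ x) m∸k≡1+x ⟩
    shellStart (suc m) x + (shellStart m k + k ⊓ suc x + suc k ⊓ suc x) + suc k ⊓ x
  ≤⟨ +-mono-≤ (+-monoʳ-≤ (shellStart (suc m) x) (+-monoʳ-≤ (shellStart m k + k ⊓ suc x) (⊓-swap-mono (suc x))))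
              (⊓-swap-mono x) ⟩
    shellStart (suc m) x + (shellStart m k + k ⊓ suc x + suc x ⊓ suc (suc k)) + x ⊓ suc (suc k)
  ≡⟨ regroup (shellStart (suc m) x) (shellStart m k) (k ⊓ suc x) (suc x ⊓ suc (suc k)) (x ⊓ suc (suc k)) ⟩
    shellStart (suc m) x + x ⊓ suc (suc k) + suc x ⊓ suc (suc k) + shellStart m k + k ⊓ suc x
  ≡⟨ cong (λ d → shellStart (suc m) x + x ⊓ d + suc x ⊓ d + shellStart m k + k ⊓ suc x) (sym 1+m∸x≡2+k) ⟩
    shellStart (suc m) (suc x) + shellStart m k + k ⊓ suc x ∎
  where
  open ≤-Reasoning
  m∸k≡1+x : m ∸ k ≡ suc x
  m∸k≡1+x = trans (cong (_∸ k) (sym x+1+k≡m)) (m+n∸n≡m (suc x) k)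
  1+m∸x≡2+k : suc m ∸ x ≡ suc (suc k)
  1+m∸x≡2+k = trans (cong (λ d → suc d ∸ x) (sym (trans (+-suc x k) x+1+k≡m)))
                    (trans (cong (_∸ x) (sym (+-suc x (suc k)))) (m+n∸m≡n x (suc (suc k))))
  ⊓-swap-mono : ∀ y → suc k ⊓ y ≤ y ⊓ suc (suc k)
  ⊓-swap-mono y = ≤-trans (≤-reflexive (⊓-comm (suc k) y)) (⊓-monoʳ-≤ y (n≤1+n (suc k)))
  regroup : ∀ a b c d e → a + (b + c + d) + e ≡ a + e + d + b + c
  regroup = solve-∀

shellStart≡[1+m]C2 : ∀ m → shellStart m m ≡ suc m C 2
shellStart≡[1+m]C2 m = *-cancelˡ-≡ (shellStart m m) (suc m C 2) 2
  (trans (2*shellStart≡m*[1+m] m) (sym (2*[1+n]C2≡n*[1+n] m)))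

-- On the (1 + n) × (1 + n) grid, the cells with x + y > n, reflected in the
-- anti-diagonal, form the staircase of size n; they get the numbers W + W' - 1,
-- W + W' - 2, ... in shell order.
module ShellNumbering (n : ℕ) where

  W W' : ℕ
  W  = shellStart (suc n) (suc n)
  W' = shellStart n n

  mirrored : ℕ → ℕ → ℕ
  mirrored x y = shellOrder n (n ∸ y) (n ∸ x)

  number : ℕ → ℕ → ℕ
  number x y with x + y <? suc n
  ... | yes _ = shellOrder (suc n) x y
  ... | no  _ = W + (W' ∸ suc (mirrored x y))

  W'≤W : W' ≤ W
  W'≤W = *-cancelˡ-≤ 2 (begin
    2 * W'              ≡⟨ 2*shellStart≡m*[1+m] n ⟩
    n * suc n           ≤⟨ *-mono-≤ (n≤1+n n) (n≤1+n (suc n)) ⟩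
    suc n * suc (suc n) ≡⟨ 2*shellStart≡m*[1+m] (suc n) ⟨
    2 * W               ∎)
    where open ≤-Reasoning

  mirror-inside : ∀ {x y} → x ≤ n → y ≤ n → ¬ x + y < suc n → (n ∸ y) + (n ∸ x) < n
  mirror-inside {x} {y} x≤n y≤n x+y≮1+n = +-cancelʳ-< (suc n) (n ∸ y + (n ∸ x)) n (begin-strict
      n ∸ y + (n ∸ x) + suc n       ≤⟨ +-monoʳ-≤ (n ∸ y + (n ∸ x)) (≮⇒≥ x+y≮1+n) ⟩
      n ∸ y + (n ∸ x) + (x + y)     ≡⟨ interchange (n ∸ y) (n ∸ x) x y ⟩
      (n ∸ y + y) + (n ∸ x + x)     ≡⟨ cong₂ _+_ (m∸n+n≡m y≤n) (m∸n+n≡m x≤n) ⟩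
      n + n                         <⟨ +-monoʳ-< n (n<1+n n) ⟩
      n + suc n                     ∎)
    where
    open ≤-Reasoning
    interchange : ∀ a b c d → a + b + (c + d) ≡ (a + d) + (b + c)
    interchange = solve-∀

  mirrored-< : ∀ {x y} → x ≤ n → y ≤ n → ¬ x + y < suc n → mirrored x y < W'
  mirrored-< {x} {y} x≤n y≤n x+y≮1+n = shellOrder-< (n ∸ y) (n ∸ x) (mirror-inside x≤n y≤n x+y≮1+n)

  cross-row : ∀ {x} y y' → x ≤ n → W' ≤ shellOrder (suc n) x y' + mirrored x y
  cross-row {x} y y' x≤n = begin
      W'                                                ≤⟨ shellStart-split x k (m+[n∸m]≡n x≤n) ⟩
      shellStart (suc n) x + shellStart n k + k ⊓ x     ≡⟨ +-assoc (shellStart (suc n) x) _ _ ⟩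
      shellStart (suc n) x + (shellStart n k + k ⊓ x)
        ≡⟨ cong (λ d → shellStart (suc n) x + (shellStart n k + k ⊓ d)) (sym (m∸[m∸n]≡n x≤n)) ⟩
      shellStart (suc n) x + (shellStart n k + rowArm n k)
        ≤⟨ +-mono-≤ (shellStart≤shellOrder x y') (colArmStart≤shellOrder (n ∸ y) k) ⟩
      shellOrder (suc n) x y' + mirrored x y            ∎
    where
    open ≤-Reasoning
    k = n ∸ x

  cross-col : ∀ {y} x x' → y ≤ n → W' ≤ shellOrder (suc n) x' y + mirrored x y
  cross-col {y} x x' y≤n = begin
      W'                                                    ≤⟨ shellStart-split y k (m+[n∸m]≡n y≤n) ⟩
      shellStart (suc n) y + shellStart n k + k ⊓ y         ≤⟨ +-monoʳ-≤ (shellStart (suc n) y + shellStart n k) k⊓y≤rowArm ⟩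
      shellStart (suc n) y + shellStart n k + rowArm (suc n) y
        ≡⟨ swap-last (shellStart (suc n) y) (shellStart n k) (rowArm (suc n) y) ⟩
      shellStart (suc n) y + rowArm (suc n) y + shellStart n k
        ≤⟨ +-mono-≤ (colArmStart≤shellOrder x' y) (shellStart≤shellOrder k (n ∸ x)) ⟩
      shellOrder (suc n) x' y + mirrored x y                ∎
    where
    open ≤-Reasoning
    k = n ∸ y
    swap-last : ∀ a b c → a + b + c ≡ a + c + b
    swap-last = solve-∀
    k⊓y≤rowArm : k ⊓ y ≤ rowArm (suc n) y
    k⊓y≤rowArm = ≤-trans (≤-reflexive (⊓-comm k y)) (⊓-monoʳ-≤ y (∸-monoˡ-≤ y (n≤1+n n)))

  upper-< : ∀ {a v} → a < W' → W' ≤ v + a → W + (W' ∸ suc a) < v + W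
  upper-< {a} {v} a<W' W'≤v+a = begin-strict
      W + (W' ∸ suc a)   ≡⟨ +-comm W _ ⟩
      (W' ∸ suc a) + W   <⟨ +-monoˡ-< W (≤-trans (≤-reflexive (sym (+-∸-assoc 1 a<W'))) W'∸a≤v) ⟩
      v + W              ∎
    where
    open ≤-Reasoning
    W'∸a≤v : W' ∸ a ≤ v
    W'∸a≤v = m≤n+o⇒m∸n≤o W' a (≤-trans W'≤v+a (≤-reflexive (+-comm v a)))

  number-close : ∀ x y x' y' → x ≤ n → y ≤ n →
                 (¬ x + y < suc n → x' + y' < suc n → W' ≤ shellOrder (suc n) x' y' + mirrored x y) →
                 number x y < number x' y' + W
  number-close x y x' y' x≤n y≤n cross with x + y <? suc n
  ... | yes x+y<1+n = <-≤-trans (shellOrder-< x y x+y<1+n) (m≤n+m W (number x' y'))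
  ... | no x+y≮1+n with x' + y' <? suc n
  ...   | yes x'+y'<1+n = upper-< (mirrored-< x≤n y≤n x+y≮1+n) (cross x+y≮1+n x'+y'<1+n)
  ...   | no _ = upper-< (mirrored-< x≤n y≤n x+y≮1+n) (≤-trans W'≤W (≤-trans (m≤m+n W _) (m≤m+n _ _)))

  number-close-row : ∀ {x} y y' → x ≤ n → y ≤ n → number x y < number x y' + W
  number-close-row {x} y y' x≤n y≤n = number-close x y x y' x≤n y≤n (λ _ _ → cross-row y y' x≤n)

  number-close-col : ∀ x x' {y} → x ≤ n → y ≤ n → number x y < number x' y + W
  number-close-col x x' {y} x≤n y≤n = number-close x y x' y x≤n y≤n (λ _ _ → cross-col x x' y≤n)

  number-injective : ∀ {x y x' y'} → x ≤ n → y ≤ n → x' ≤ n → y' ≤ n →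
                     number x y ≡ number x' y' → x ≡ x' × y ≡ y'
  number-injective {x} {y} {x'} {y'} x≤n y≤n x'≤n y'≤n eq with x + y <? suc n | x' + y' <? suc n
  ... | yes x+y<1+n | yes x'+y'<1+n = shellOrder-injective x+y<1+n x'+y'<1+n eq
  ... | yes x+y<1+n | no _ = contradiction (subst (_< W) eq (shellOrder-< x y x+y<1+n)) (≤⇒≯ (m≤m+n W _))
  ... | no _ | yes x'+y'<1+n = contradiction (subst (_< W) (sym eq) (shellOrder-< x' y' x'+y'<1+n)) (≤⇒≯ (m≤m+n W _))
  ... | no x+y≮1+n | no x'+y'≮1+n
    with shellOrder-injective {n} (mirror-inside x≤n y≤n x+y≮1+n) (mirror-inside x'≤n y'≤n x'+y'≮1+n)
           (suc-injective (∸-cancelˡ-≡ (mirrored-< x≤n y≤n x+y≮1+n) (mirrored-< x'≤n y'≤n x'+y'≮1+n)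
                                       (+-cancelˡ-≡ W _ _ eq)))
  ... | n∸y≡n∸y' , n∸x≡n∸x' = ∸-cancelˡ-≡ x≤n x'≤n n∸x≡n∸x' , ∸-cancelˡ-≡ y≤n y'≤n n∸y≡n∸y'

∣m⊖n∣<o : ∀ {m n o} → m < n + o → n < m + o → ∣ m ⊖ n ∣ < o
∣m⊖n∣<o {m} {n} {o} m<n+o n<m+o = [ ascending , descending ]′ (≤-total m n)
  where
  gap : ∀ {a b} → a ≤ b → b < a + o → b ∸ a < o
  gap {a} a≤b b<a+o = subst (_ <_) (m+n∸m≡n a o) (∸-monoˡ-< b<a+o a≤b)
  ascending : m ≤ n → ∣ m ⊖ n ∣ < o
  ascending m≤n = subst (_< o) (sym (ℤ.∣⊖∣-≤ m≤n)) (gap m≤n n<m+o)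
  descending : n ≤ m → ∣ m ⊖ n ∣ < o
  descending n≤m = subst (_< o) (sym (trans (ℤ.∣m⊖n∣≡∣n⊖m∣ m n) (ℤ.∣⊖∣-≤ n≤m))) (gap n≤m m<n+o)

shellNumbering : ∀ n → EdgeNumbering (suc n)
shellNumbering n = f , f-injective
  where
  open ShellNumbering n
  f : Edge (suc n) → ℤ
  f (i , j) = + number (toℕ i) (toℕ j)
  f-injective : Injective _≡_ _≡_ f
  f-injective {i , j} {i' , j'} eq
    with number-injective (toℕ≤pred[n] i) (toℕ≤pred[n] j) (toℕ≤pred[n] i') (toℕ≤pred[n] j') (ℤ.+-injective eq)
  ... | x≡x' , y≡y' = cong₂ _,_ (toℕ-injective x≡x') (toℕ-injective y≡y')

B'f-shellNumbering : ∀ n → B'f (shellNumbering n) ≤ suc (suc n) C 2 ∸ 1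
B'f-shellNumbering n = B'f≤ (shellNumbering n) close
  where
  open ShellNumbering n
  within : ∀ {a b} → a < b + W → b < a + W → ∣ + a ℤ.- + b ∣ ≤ suc (suc n) C 2 ∸ 1
  within {a} {b} a<b+W b<a+W = begin
    ∣ + a ℤ.- + b ∣      ≡⟨ cong ∣_∣ (ℤ.[+m]-[+n]≡m⊖n a b) ⟩
    ∣ a ⊖ b ∣            ≤⟨ suc[m]≤n⇒m≤pred[n] (∣m⊖n∣<o a<b+W b<a+W) ⟩
    pred W               ≡⟨ pred[m∸n]≡m∸[1+n] W 0 ⟩
    W ∸ 1                ≡⟨ cong (_∸ 1) (shellStart≡[1+m]C2 (suc n)) ⟩
    suc (suc n) C 2 ∸ 1  ∎
    where open ≤-Reasoning
  close : ∀ {e e'} → IncidentDistinct e e' →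
          ∣ proj₁ (shellNumbering n) e ℤ.- proj₁ (shellNumbering n) e' ∣ ≤ suc (suc n) C 2 ∸ 1
  close {i , j} {.i , j'} (_ , inj₁ refl) = within
    (number-close-row (toℕ j) (toℕ j') (toℕ≤pred[n] i) (toℕ≤pred[n] j))
    (number-close-row (toℕ j') (toℕ j) (toℕ≤pred[n] i) (toℕ≤pred[n] j'))
  close {i , j} {i' , .j} (_ , inj₂ refl) = within
    (number-close-col (toℕ i) (toℕ i') (toℕ≤pred[n] i) (toℕ≤pred[n] j))
    (number-close-col (toℕ i') (toℕ i) (toℕ≤pred[n] i') (toℕ≤pred[n] j))

theorem14 : ∀ (n : ℕ) → IsEdgeBandwidthKnn (suc n) (((suc n + 1) C 2) ∸ 1)
theorem14 n = subst (λ k → IsEdgeBandwidthKnn (suc n) (k C 2 ∸ 1)) (+-comm 1 (suc n))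
  ((shellNumbering n , ≤-antisym (B'f-shellNumbering n) (B'f-lowerBound (shellNumbering n))) , B'f-lowerBound)
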